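{- In any phase of Algorithm A, the number of requests $r^t$ of that phase such that the algorithm's current state $q^t$ does not satisfy $r^t$ is at most $2^k$.
   Context: Setting: generalized $k$-server in the uniform metric case, where each server $i\in[k]$ lives in a uniform metric with point set $[n]$ and unit distances. A state (configuration) is $q=(q_1,\dots,q_k)\in[n]^k$ and a request is $r=(r_1,\dots,r_k)\in[n]^k$; the state $q$ satisfies $r$ if $q_i=r_i$ for some $i\in[k]$. Algorithm A works in phases. When a phase begins, the algorithm is in some arbitrary state. Number the requests of the current phase $r^1,r^2,\dots$ and let $q^t$ be the state when $r^t$ arrives. On arrival of $r^t$: if $q^t$ satisfies $r^t$, set $q^{t+1}=q^t$. Otherwise, if there exists a state $q$ satisfying all of $r^1,\dots,r^t$, set $q^{t+1}$ to (any) such $q$; if no such state exists, set $q^{t+1}$ to an arbitrary state satisfying $r^t$ and end the current phase (the next request begins a new phase). -}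

module Defs where

open import Data.Nat using (ℕ; suc; _≤_; _<_)
open import Data.Fin using (Fin)
open import Data.Fin.Properties using (any?)
import Data.Fin.Properties as FinP
open import Data.Product using (Σ; ∃; _×_; _,_)
open import Data.Sum using (_⊎_)
open import Data.List using (List; length; filter; upTo)
open import Relation.Nullary using (¬_; Dec; ¬?)
open import Relation.Binary.PropositionalEquality using (_≡_)

-- A configuration / request of the generalized k-server problem on k uniform
-- metrics, each with point set [n] = Fin n : a k-tuple of points.
Config : ℕ → ℕ → Set
Config k n = Fin k → Fin n

Satisfies : ∀ {k n} → Config k n → Config k n → Set
Satisfies q r = ∃ λ i → q i ≡ r i

satisfies? : ∀ {k n} (q r : Config k n) → Dec (Satisfies q r)
satisfies? q r = any? (λ i → q i FinP.≟ r i)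

SatisfiesUpTo : ∀ {k n} → (ℕ → Config k n) → ℕ → Config k n → Set
SatisfiesUpTo rs t q = ∀ s → s ≤ t → Satisfies q (rs s)

Feasible : ∀ {k n} → (ℕ → Config k n) → ℕ → Set
Feasible {k} {n} rs t = Σ (Config k n) (SatisfiesUpTo rs t)

-- A step of Algorithm A on request rs t (from state q to state q') that does
-- not end the phase: either a hit (state unchanged), or a miss where some
-- state satisfies all requests of the phase so far and q' is such a state.
StepContinue : ∀ {k n} → (ℕ → Config k n) → ℕ → Config k n → Config k n → Set
StepContinue rs t q q' =
  (Satisfies q (rs t) × q' ≡ q)
  ⊎ (¬ Satisfies q (rs t) × Feasible rs t × SatisfiesUpTo rs t q')

-- A step that ends the phase: a miss where no state satisfies all requests
-- of the phase so far; q' is an arbitrary state satisfying rs t.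
StepEnd : ∀ {k n} → (ℕ → Config k n) → ℕ → Config k n → Config k n → Set
StepEnd rs t q q' =
  ¬ Satisfies q (rs t) × ¬ Feasible rs t × Satisfies q' (rs t)

-- (rs, qs) is a run of Algorithm A during one phase consisting of the
-- requests rs 0, ..., rs (m-1); qs t is the state when rs t arrives
-- (qs 0 arbitrary).  Only the last request may end the phase (the phase
-- may also be unfinished, i.e. its last request need not end it).
IsPhase : ∀ {k n} → ℕ → (ℕ → Config k n) → (ℕ → Config k n) → Set
IsPhase m rs qs =
  ∀ t → t < m →
    StepContinue rs t (qs t) (qs (suc t))
    ⊎ (StepEnd rs t (qs t) (qs (suc t)) × suc t ≡ m)

misses : ∀ {k n} → ℕ → (ℕ → Config k n) → (ℕ → Config k n) → ℕ
misses m rs qs = length (filter (λ t → ¬? (satisfies? (qs t) (rs t))) (upTo m))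

module Submission where

-- To a miss at time t of a phase attach the
-- polynomial  P_t(x) = Π_i (x_i − r^t_i)  in k variables, so that
-- P_t(q) = 0 exactly when q satisfies r^t.  A miss means P_t(q^t) ≠ 0, while
-- the phase invariant says that every later state q^t' (t < t') still
-- satisfies r^t, i.e. P_t(q^t') = 0.  Writing P_t(q) as the dot product of
-- the coefficient vector of P_t with the vector of monomials of q (both in
-- ℤ^(2^k), since P_t is multilinear), the misses of a phase give a
-- "triangular" family of vector pairs, and such a family has at most as
-- many members as the dimension.

open import Defs
open import Data.Nat using (ℕ; zero; suc; _≤_; _<_; _^_; z≤n; s≤s) renaming (_*_ to _*ℕ_)
import Data.Nat.Properties as ℕP
open import Data.Fin using (Fin; toℕ) renaming (zero to fzero; suc to fsuc)
import Data.Fin.Properties as FinP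
open import Data.Integer using (ℤ; +_; 0ℤ; 1ℤ; _+_; _*_; _-_; -_; _≟_)
import Data.Integer.Properties as ℤP
open import Data.Integer.Tactic.RingSolver using (solve-∀)
open import Data.Vec using (Vec; []; _∷_; _++_; lookup; removeAt; zipWith)
import Data.Vec as Vec
import Data.Vec.Properties as VecP
open import Data.List using (List; []; _∷_; length; filter; upTo)
import Data.List as List
import Data.List.Properties as ListP
open import Data.List.Relation.Unary.All as All using (All; []; _∷_)
import Data.List.Relation.Unary.All.Properties as AllP
open import Data.List.Relation.Unary.AllPairs as AllPairs using (AllPairs; []; _∷_)
import Data.List.Relation.Unary.AllPairs.Properties as AllPairsP
open import Data.Product using (∃; _×_; _,_; proj₁)
open import Data.Sum using (_⊎_; inj₁; inj₂)
open import Data.Empty using (⊥-elim)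
open import Relation.Nullary using (¬_; yes; no; ¬?)
open import Relation.Binary.PropositionalEquality
  using (_≡_; _≢_; refl; sym; trans; cong; cong₂; subst; module ≡-Reasoning)
open import Function using (_∘_)

open ≡-Reasoning

AllPairs-withAll : ∀ {A : Set} {P : A → Set} {R : A → A → Set} {xs : List A} →
  All P xs → AllPairs R xs → AllPairs (λ x y → R x y × P x × P y) xs
AllPairs-withAll [] [] = []
AllPairs-withAll (px ∷ pxs) (rx ∷ rxs) =
  All.zipWith (λ { (r , py) → r , px , py }) (rx , pxs) ∷ AllPairs-withAll pxs rxs

dot : ∀ {d} → Vec ℤ d → Vec ℤ d → ℤ
dot [] [] = 0ℤ
dot (x ∷ xs) (y ∷ ys) = x * y + dot xs ys

combine : ∀ {d} → ℤ → Vec ℤ d → ℤ → Vec ℤ d → Vec ℤ d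
combine a v c w = zipWith (λ x y → a * x - c * y) v w

dot-combine : ∀ {d} (u v w : Vec ℤ d) a c →
  dot u (combine a v c w) ≡ a * dot u v - c * dot u w
dot-combine [] [] [] a c = vanish a c
  where
  vanish : ∀ a c → 0ℤ ≡ a * 0ℤ - c * 0ℤ
  vanish = solve-∀
dot-combine (x ∷ u) (y ∷ v) (z ∷ w) a c =
  trans (cong (λ s → x * (a * y - c * z) + s) (dot-combine u v w a c))
        (distribute a c x y z (dot u v) (dot u w))
  where
  distribute : ∀ a c x y z D E →
    x * (a * y - c * z) + (a * D - c * E) ≡ a * (x * y + D) - c * (x * z + E)
  distribute = solve-∀

dot-removeAt : ∀ {d} (j : Fin (suc d)) (u w : Vec ℤ (suc d)) →
  dot u w ≡ lookup u j * lookup w j + dot (removeAt u j) (removeAt w j)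
dot-removeAt fzero (x ∷ u) (y ∷ w) = refl
dot-removeAt (fsuc j) (x ∷ u@(_ ∷ _)) (y ∷ w@(_ ∷ _)) =
  trans (cong (λ s → x * y + s) (dot-removeAt j u w))
        (swap (x * y) (lookup u j * lookup w j) (dot (removeAt u j) (removeAt w j)))
  where
  swap : ∀ p q r → p + (q + r) ≡ q + (p + r)
  swap = solve-∀

dot-removeAt-zero : ∀ {d} (j : Fin (suc d)) (u w : Vec ℤ (suc d)) →
  lookup w j ≡ 0ℤ → dot (removeAt u j) (removeAt w j) ≡ dot u w
dot-removeAt-zero j u w wj≡0 = sym (begin
  dot u w                          ≡⟨ dot-removeAt j u w ⟩
  lookup u j * lookup w j + rest   ≡⟨ cong (λ z → lookup u j * z + rest) wj≡0 ⟩
  lookup u j * 0ℤ + rest           ≡⟨ cong (λ z → z + rest) (ℤP.*-zeroʳ (lookup u j)) ⟩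
  0ℤ + rest                        ≡⟨ ℤP.+-identityˡ rest ⟩
  rest                             ∎)
  where
  rest : ℤ
  rest = dot (removeAt u j) (removeAt w j)

nonzero-coordinate : ∀ {d} (u v : Vec ℤ d) → dot u v ≢ 0ℤ → ∃ λ j → lookup v j ≢ 0ℤ
nonzero-coordinate [] [] uv≢0 = ⊥-elim (uv≢0 refl)
nonzero-coordinate (x ∷ u) (y ∷ v) uv≢0 with y ≟ 0ℤ
... | no y≢0 = fzero , y≢0
... | yes refl with nonzero-coordinate u v (uv≢0 ∘ dropZero)
  where
  dropZero : dot u v ≡ 0ℤ → x * 0ℤ + dot u v ≡ 0ℤ
  dropZero uv≡0 = begin
    x * 0ℤ + dot u v  ≡⟨ cong (λ s → s + dot u v) (ℤP.*-zeroʳ x) ⟩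
    0ℤ + dot u v      ≡⟨ ℤP.+-identityˡ (dot u v) ⟩
    dot u v           ≡⟨ uv≡0 ⟩
    0ℤ                ∎
...   | j , vj≢0 = fsuc j , vj≢0

-- An item (u , v) pairs a point u with (the coefficients of) a linear form v.
Item : ℕ → Set
Item d = Vec ℤ d × Vec ℤ d

Annihilates : ∀ {d} → Item d → Item d → Set
Annihilates (_ , v) (u , _) = dot u v ≡ 0ℤ

NonDegenerate : ∀ {d} → Item d → Set
NonDegenerate (u , v) = dot u v ≢ 0ℤ

-- Given a pivot item whose form p has a nonzero
-- coordinate a = p_j, every item (u , v) is sent to ℤ^d by deleting
-- coordinate j of u and of  a·v − v_j·p  (which vanishes at j).  On points
-- annihilated by p this multiplies every pairing by a.
module Elimination {d} (p : Vec ℤ (suc d)) (j : Fin (suc d)) where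

  a : ℤ
  a = lookup p j

  reduce : Item (suc d) → Item d
  reduce (u , v) = removeAt u j , removeAt (combine a v (lookup v j) p) j

  combine-vanishes : ∀ (v : Vec ℤ (suc d)) → lookup (combine a v (lookup v j) p) j ≡ 0ℤ
  combine-vanishes v = trans (VecP.lookup-zipWith _ j v p) (cancel a (lookup v j))
    where
    cancel : ∀ a y → a * y - y * a ≡ 0ℤ
    cancel = solve-∀

  reduce-dot : ∀ (u v : Vec ℤ (suc d)) → dot u p ≡ 0ℤ →
    dot (removeAt u j) (removeAt (combine a v (lookup v j) p) j) ≡ a * dot u v
  reduce-dot u v up≡0 = begin
    dot (removeAt u j) (removeAt (combine a v c p) j)  ≡⟨ dot-removeAt-zero j u _ (combine-vanishes v) ⟩
    dot u (combine a v c p)                            ≡⟨ dot-combine u v p a c ⟩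
    a * dot u v - c * dot u p                          ≡⟨ cong (λ z → a * dot u v - c * z) up≡0 ⟩
    a * dot u v - c * 0ℤ                               ≡⟨ dropZero a c (dot u v) ⟩
    a * dot u v                                        ∎
    where
    c : ℤ
    c = lookup v j
    dropZero : ∀ a c D → a * D - c * 0ℤ ≡ a * D
    dropZero = solve-∀

  reduce-annihilates : ∀ {x y : Item (suc d)} → dot (proj₁ y) p ≡ 0ℤ →
    Annihilates x y → Annihilates (reduce x) (reduce y)
  reduce-annihilates {_ , v} {u , _} up≡0 uv≡0 =
    trans (reduce-dot u v up≡0) (trans (cong (a *_) uv≡0) (ℤP.*-zeroʳ a))

  -- Items whose point is annihilated by p stay non-degenerate, as ℤ has no
  -- zero divisors.
  reduce-nonDegenerate : a ≢ 0ℤ → ∀ {x : Item (suc d)} → dot (proj₁ x) p ≡ 0ℤ →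
    NonDegenerate x → NonDegenerate (reduce x)
  reduce-nonDegenerate a≢0 {u , v} up≡0 uv≢0 reduced≡0
    with ℤP.i*j≡0⇒i≡0∨j≡0 a (trans (sym (reduce-dot u v up≡0)) reduced≡0)
  ... | inj₁ a≡0  = a≢0 a≡0
  ... | inj₂ uv≡0 = uv≢0 uv≡0

-- The first
-- item's form p has a nonzero coordinate, since it does not vanish at the
-- first point; eliminating against p maps the remaining items, whose points
-- p annihilates, to a triangular family in ℤ^(d-1).
triangular-bound : ∀ d (xs : List (Item d)) →
  AllPairs Annihilates xs → All NonDegenerate xs → length xs ≤ d
triangular-bound d [] _ _ = z≤n
triangular-bound zero (([] , []) ∷ _) _ (uv≢0 ∷ _) = ⊥-elim (uv≢0 refl)
triangular-bound (suc d) ((u , p) ∷ xs) (pivotAnnihilates ∷ later) (up≢0 ∷ nonDegenerate)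
  with nonzero-coordinate u p up≢0
... | j , a≢0 =
  s≤s (subst (_≤ d) (ListP.length-map reduce xs)
        (triangular-bound d (List.map reduce xs) reducedAnnihilates reducedNonDegenerate))
  where
  open Elimination p j
  reducedAnnihilates : AllPairs Annihilates (List.map reduce xs)
  reducedAnnihilates = AllPairsP.map⁺
    (AllPairs.map (λ {x} {y} → λ { (xy , _ , py) → reduce-annihilates {x} {y} py xy })
                  (AllPairs-withAll pivotAnnihilates later))
  reducedNonDegenerate : All NonDegenerate (List.map reduce xs)
  reducedNonDegenerate = AllP.map⁺
    (All.zipWith (λ {x} → λ { (px , nx) → reduce-nonDegenerate a≢0 {x} px nx })
                 (pivotAnnihilates , nonDegenerate))

_⊗_ : ∀ {m l} → Vec ℤ m → Vec ℤ l → Vec ℤ (m *ℕ l)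
[] ⊗ w = []
(x ∷ a) ⊗ w = Vec.map (x *_) w ++ a ⊗ w

dot-++ : ∀ {m l} (a c : Vec ℤ m) (b e : Vec ℤ l) →
  dot (a ++ b) (c ++ e) ≡ dot a c + dot b e
dot-++ [] [] b e = sym (ℤP.+-identityˡ (dot b e))
dot-++ (x ∷ a) (y ∷ c) b e =
  trans (cong (λ s → x * y + s) (dot-++ a c b e)) (sym (ℤP.+-assoc (x * y) (dot a c) (dot b e)))

dot-scale : ∀ {l} x y (w z : Vec ℤ l) →
  dot (Vec.map (x *_) w) (Vec.map (y *_) z) ≡ x * y * dot w z
dot-scale x y [] [] = sym (ℤP.*-zeroʳ (x * y))
dot-scale x y (w₀ ∷ w) (z₀ ∷ z) =
  trans (cong (λ s → x * w₀ * (y * z₀) + s) (dot-scale x y w z)) (factor x y w₀ z₀ (dot w z))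
  where
  factor : ∀ x y w₀ z₀ D → x * w₀ * (y * z₀) + x * y * D ≡ x * y * (w₀ * z₀ + D)
  factor = solve-∀

dot-⊗ : ∀ {m l} (a b : Vec ℤ m) (w z : Vec ℤ l) → dot (a ⊗ w) (b ⊗ z) ≡ dot a b * dot w z
dot-⊗ [] [] w z = refl
dot-⊗ (x ∷ a) (y ∷ b) w z = begin
  dot (Vec.map (x *_) w ++ a ⊗ w) (Vec.map (y *_) z ++ b ⊗ z)
    ≡⟨ dot-++ (Vec.map (x *_) w) (Vec.map (y *_) z) (a ⊗ w) (b ⊗ z) ⟩
  dot (Vec.map (x *_) w) (Vec.map (y *_) z) + dot (a ⊗ w) (b ⊗ z)
    ≡⟨ cong₂ _+_ (dot-scale x y w z) (dot-⊗ a b w z) ⟩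
  x * y * dot w z + dot a b * dot w z
    ≡⟨ sym (ℤP.*-distribʳ-+ (dot w z) (x * y) (dot a b)) ⟩
  (x * y + dot a b) * dot w z
    ∎

toℤ : ∀ {n} → Fin n → ℤ
toℤ i = + toℕ i

monomials : ∀ {n} k → Config k n → Vec ℤ (2 ^ k)
monomials zero q = 1ℤ ∷ []
monomials (suc k) q = (1ℤ ∷ toℤ (q fzero) ∷ []) ⊗ monomials k (q ∘ fsuc)

-- The coefficient vector of the polynomial  Π_i (x_i − r_i).
coefficients : ∀ {n} k → Config k n → Vec ℤ (2 ^ k)
coefficients zero r = 1ℤ ∷ []
coefficients (suc k) r = (- toℤ (r fzero) ∷ 1ℤ ∷ []) ⊗ coefficients k (r ∘ fsuc)

gap : ∀ {n} k → Config k n → Config k n → ℤ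
gap zero q r = 1ℤ
gap (suc k) q r = (toℤ (q fzero) - toℤ (r fzero)) * gap k (q ∘ fsuc) (r ∘ fsuc)

-- Pairing monomials with coefficients evaluates the polynomial:  each factor
-- contributes  (1 , q_i)·(−r_i , 1) = q_i − r_i.
dot-monomials-coefficients : ∀ {n} k (q r : Config k n) →
  dot (monomials k q) (coefficients k r) ≡ gap k q r
dot-monomials-coefficients zero q r = refl
dot-monomials-coefficients (suc k) q r =
  trans (dot-⊗ (1ℤ ∷ toℤ (q fzero) ∷ []) (- toℤ (r fzero) ∷ 1ℤ ∷ [])
               (monomials k (q ∘ fsuc)) (coefficients k (r ∘ fsuc)))
        (cong₂ _*_ (linear (toℤ (q fzero)) (toℤ (r fzero)))
                   (dot-monomials-coefficients k (q ∘ fsuc) (r ∘ fsuc)))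
  where
  linear : ∀ x y → 1ℤ * (- y) + (x * 1ℤ + 0ℤ) ≡ x - y
  linear = solve-∀

satisfies⇒gap≡0 : ∀ {n} k (q r : Config k n) → Satisfies q r → gap k q r ≡ 0ℤ
satisfies⇒gap≡0 (suc k) q r (fzero , q₀≡r₀) =
  cong (_* gap k (q ∘ fsuc) (r ∘ fsuc)) (ℤP.i≡j⇒i-j≡0 (cong toℤ q₀≡r₀))
satisfies⇒gap≡0 (suc k) q r (fsuc i , qᵢ≡rᵢ) =
  trans (cong ((toℤ (q fzero) - toℤ (r fzero)) *_) (satisfies⇒gap≡0 k (q ∘ fsuc) (r ∘ fsuc) (i , qᵢ≡rᵢ)))
        (ℤP.*-zeroʳ (toℤ (q fzero) - toℤ (r fzero)))

gap≡0⇒satisfies : ∀ {n} k (q r : Config k n) → gap k q r ≡ 0ℤ → Satisfies q r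
gap≡0⇒satisfies zero q r ()
gap≡0⇒satisfies (suc k) q r gap≡0 with ℤP.i*j≡0⇒i≡0∨j≡0 (toℤ (q fzero) - toℤ (r fzero)) gap≡0
... | inj₁ q₀-r₀≡0 =
  fzero , FinP.toℕ-injective (ℤP.+-injective (ℤP.i-j≡0⇒i≡j _ _ q₀-r₀≡0))
... | inj₂ rest≡0 with gap≡0⇒satisfies k (q ∘ fsuc) (r ∘ fsuc) rest≡0
...   | i , qᵢ≡rᵢ = fsuc i , qᵢ≡rᵢ

Missed : ∀ {k n} → (ℕ → Config k n) → (ℕ → Config k n) → ℕ → Set
Missed rs qs t = ¬ Satisfies (qs t) (rs t)

-- Once a request of the phase is missed, every later state of the phase
-- satisfies it: a hit keeps the state, a miss that continues the phase
-- moves to a state satisfying all requests so far, and only the last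
-- request can end the phase.
missed-stays-satisfied : ∀ {k n m} {rs qs : ℕ → Config k n} → IsPhase m rs qs →
  ∀ {t t'} → t < t' → t' < m → Missed rs qs t → Satisfies (qs t') (rs t)
missed-stays-satisfied {m = m} {rs} {qs} phase {t} {suc s} t<t' t'<m missed =
  step (phase s s<m)
  where
  s<m : s < m
  s<m = ℕP.<-trans (ℕP.n<1+n s) t'<m

  t≤s : t ≤ s
  t≤s = ℕP.≤-pred t<t'

  satisfiedAt-s : Satisfies (qs s) (rs s) → Satisfies (qs s) (rs t)
  satisfiedAt-s hit with ℕP.m≤n⇒m<n∨m≡n t≤s
  ... | inj₁ t<s  = missed-stays-satisfied phase t<s s<m missed
  ... | inj₂ refl = ⊥-elim (missed hit)

  step : StepContinue rs s (qs s) (qs (suc s)) ⊎ (StepEnd rs s (qs s) (qs (suc s)) × suc s ≡ m) →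
         Satisfies (qs (suc s)) (rs t)
  step (inj₁ (inj₁ (hit , q'≡q)))           = subst (λ q → Satisfies q (rs t)) (sym q'≡q) (satisfiedAt-s hit)
  step (inj₁ (inj₂ (_ , _ , satisfiesAll))) = satisfiesAll t t≤s
  step (inj₂ (_ , phaseEnds))               = ⊥-elim (ℕP.<-irrefl phaseEnds t'<m)

missTimes : ∀ {k n} → ℕ → (ℕ → Config k n) → (ℕ → Config k n) → List ℕ
missTimes m rs qs = filter (λ t → ¬? (satisfies? (qs t) (rs t))) (upTo m)

missTimes-missed : ∀ {k n} m (rs qs : ℕ → Config k n) → All (Missed rs qs) (missTimes m rs qs)
missTimes-missed m rs qs = AllP.all-filter (λ t → ¬? (satisfies? (qs t) (rs t))) (upTo m)

missTimes-increasing : ∀ {k n} m (rs qs : ℕ → Config k n) →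
  AllPairs (λ t t' → t < t' × t' < m) (missTimes m rs qs)
missTimes-increasing m rs qs =
  AllPairsP.filter⁺ (λ t → ¬? (satisfies? (qs t) (rs t)))
    (AllPairsP.applyUpTo⁺₁ (λ t → t) m (λ t<t' t'<m → t<t' , t'<m))

-- The misses of a phase, each turned into (monomials of q^t, coefficients of
-- Π_i (x_i − r^t_i)), form a triangular family in ℤ^(2^k).
theorem4 : (k n m : ℕ) (rs qs : ℕ → Config k n) →
    IsPhase m rs qs → misses m rs qs ≤ 2 ^ k
theorem4 k n m rs qs phase =
  subst (_≤ 2 ^ k) (ListP.length-map item (missTimes m rs qs))
    (triangular-bound (2 ^ k) (List.map item (missTimes m rs qs)) annihilating nonDegenerate)
  where
  item : ℕ → Item (2 ^ k)
  item t = monomials k (qs t) , coefficients k (rs t)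

  itemPairing : ∀ t t' → dot (monomials k (qs t')) (coefficients k (rs t)) ≡ gap k (qs t') (rs t)
  itemPairing t t' = dot-monomials-coefficients k (qs t') (rs t)

  annihilating : AllPairs Annihilates (List.map item (missTimes m rs qs))
  annihilating = AllPairsP.map⁺ (AllPairs.map
    (λ {t} {t'} → λ { ((t<t' , t'<m) , missed , _) → trans (itemPairing t t')
        (satisfies⇒gap≡0 k (qs t') (rs t) (missed-stays-satisfied phase t<t' t'<m missed)) })
    (AllPairs-withAll (missTimes-missed m rs qs) (missTimes-increasing m rs qs)))

  nonDegenerate : All NonDegenerate (List.map item (missTimes m rs qs))
  nonDegenerate = AllP.map⁺ (All.map
    (λ {t} missed → missed ∘ gap≡0⇒satisfies k (qs t) (rs t) ∘ trans (sym (itemPairing t t)))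
    (missTimes-missed m rs qs))
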